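{- Let $n \geq m \geq 2$ be integers and let $K_{n,m}$ be the complete bipartite graph with parts of sizes $n$ and $m$. Then: (i) If $n$ is even, then $\mathrm{sg_e}(K_{n,m}) = n+1$ if $n=m$, and $\mathrm{sg_e}(K_{n,m}) = n$ if $n \geq m+1$. (ii) If $n$ is odd, then $\mathrm{sg_e}(K_{n,m}) = n+2$ if $n=m$, $\mathrm{sg_e}(K_{n,m}) = n+1$ if $n=m+1$, and $\mathrm{sg_e}(K_{n,m}) = n$ if $n \geq m+2$.
   Context: All graphs are finite and simple. For a graph $G$, a set $X\subseteq V(G)$ is a strong edge geodetic set if to each (unordered) pair of vertices $u,v\in X$ one can assign one shortest $u,v$-path $P_{uv}$ (or no path) such that every edge of $G$ lies on at least one of the assigned paths. The strong edge geodetic number $\mathrm{sg_e}(G)$ is the minimum cardinality of a strong edge geodetic set of $G$. -}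

module Defs where

open import Data.Nat using (ℕ; zero; suc; _+_; _≤_; _<_)
open import Data.Fin using (Fin; toℕ)
import Data.Fin as F
open import Data.Fin.Subset using (Subset; _∈_; ∣_∣)
open import Data.List using (List; []; _∷_)
open import Data.List.Relation.Unary.Unique.Propositional using (Unique)
open import Data.Maybe using (Maybe; just)
open import Data.Product using (Σ; ∃; _×_; _,_; proj₁; proj₂)
open import Data.Sum using (_⊎_)
open import Relation.Binary.PropositionalEquality using (_≡_)
open import Relation.Nullary using (¬_)
open import Level using (0ℓ)

record Graph : Set₁ where
  field
    N     : ℕ
    Adj   : Fin N → Fin N → Set
    sym   : ∀ {x y} → Adj x y → Adj y x
    irrefl : ∀ {x} → ¬ Adj x x

module _ (G : Graph) where
  open Graph G

  data Walk : Fin N → Fin N → ℕ → Set where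
    [] : ∀ {u} → Walk u u 0
    _∷_ : ∀ {u w v k} → Adj u w → Walk w v k → Walk u v (suc k)

  vertices : ∀ {u v k} → Walk u v k → List (Fin N)
  vertices {u} [] = u ∷ []
  vertices {u} (_ ∷ p) = u ∷ vertices p

  record Path (u v : Fin N) (k : ℕ) : Set where
    constructor mkPath
    field
      walk     : Walk u v k
      distinct : Unique (vertices walk)

  record ShortestPath (u v : Fin N) : Set where
    constructor mkShortest
    field
      len      : ℕ
      path     : Path u v len
      shortest : ∀ {k} → Path u v k → len ≤ k

  -- The (undirected) edge {x,y} lies on the walk: x,y are consecutive
  -- vertices of the walk, in either order.
  data EdgeOnWalk (x y : Fin N) : ∀ {u v k} → Walk u v k → Set where
    here→ : ∀ {w v k} {e : Adj x w} {p : Walk w v k} → w ≡ y →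
            EdgeOnWalk x y {x} (e ∷ p)
    here← : ∀ {u w v k} {e : Adj u w} {p : Walk w v k} → u ≡ y → w ≡ x →
            EdgeOnWalk x y (e ∷ p)
    there : ∀ {u w v k} {e : Adj u w} {p : Walk w v k} →
            EdgeOnWalk x y p → EdgeOnWalk x y (e ∷ p)

  EdgeOn : ∀ (x y : Fin N) {u v} → ShortestPath u v → Set
  EdgeOn x y P = EdgeOnWalk x y (Path.walk (ShortestPath.path P))

  -- Assignment: to each unordered pair {u,v} of distinct vertices of X
  -- (represented as u < v) assign one shortest u,v-path or no path.
  Assignment : Subset N → Set
  Assignment X = (u v : Fin N) → u ∈ X → v ∈ X → u F.< v → Maybe (ShortestPath u v)

  IsStrongEdgeGeodetic : Subset N → Set
  IsStrongEdgeGeodetic X =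
    Σ (Assignment X) λ a →
      ∀ x y → Adj x y →
        Σ (Fin N) λ u → Σ (Fin N) λ v → Σ (u ∈ X) λ u∈X → Σ (v ∈ X) λ v∈X →
          Σ (u F.< v) λ u<v → Σ (ShortestPath u v) λ P →
            (a u v u∈X v∈X u<v ≡ just P) × EdgeOn x y P

  sgₑ≡ : ℕ → Set
  sgₑ≡ k = (Σ (Subset N) λ X → IsStrongEdgeGeodetic X × ∣ X ∣ ≡ k)
         × (∀ X → IsStrongEdgeGeodetic X → k ≤ ∣ X ∣)

-- Complete bipartite graph K_{n,m}: vertices Fin (n + m); vertices with
-- index < n form the part of size n, the others the part of size m.
KAdj : (n m : ℕ) → Fin (n + m) → Fin (n + m) → Set
KAdj n m x y = (toℕ x < n × n ≤ toℕ y) ⊎ (n ≤ toℕ x × toℕ y < n)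

K : ℕ → ℕ → Graph
K n m = record { N = n + m ; Adj = KAdj n m ; sym = s ; irrefl = i }
  where
  open import Data.Sum using (inj₁; inj₂)
  open import Data.Nat.Properties using (<⇒≱)
  s : ∀ {x y} → KAdj n m x y → KAdj n m y x
  s (inj₁ (a , b)) = inj₂ (b , a)
  s (inj₂ (a , b)) = inj₁ (b , a)
  i : ∀ {x} → ¬ KAdj n m x x
  i (inj₁ (a , b)) = <⇒≱ a b
  i (inj₂ (a , b)) = <⇒≱ b a

-- Every geodesic of K_{n,m} has length at most 2, so an edge at a vertex x outside a strong
-- edge geodetic set X can only be covered by an assigned path s–x–t. Hence all neighbours of x
-- lie in X, and one whole part, say of size p, lies in X. Each of the μ missing vertices of the
-- other part is then the midpoint of at least ⌈p/2⌉ assigned pairs, and distinct vertices use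
-- distinct pairs, so ⌈p/2⌉ μ ≤ p(p−1)/2: at most p−1 vertices are missing if p is even, and at
-- most p−2 if p is odd.
--
-- Conversely, colour the pairs of the n-part so that every vertex meets every colour class
-- (a 1-factorisation of K_n for n even, extended by one vertex for n odd), put the n-part and t
-- vertices of the m-part into X, and route the pairs of colour c through the c-th remaining
-- vertex of the m-part. The m − t colours needed exist as long as m − t ≤ n − 1 for n even and
-- m − t ≤ n − 2 for n odd.

module Submission where

open import Defs
open import Data.Nat using (ℕ; _+_; _≤_; suc)
open import Data.Nat.Divisibility using (_∣_)
open import Relation.Nullary using (¬_)
open import Data.Product using (_×_)
open import Relation.Binary.PropositionalEquality using (_≡_)

open import Data.Bool using (Bool; true; false; not)
open import Data.Empty using (⊥-elim)
open import Data.Fin using (Fin; zero; suc; toℕ; fromℕ<; _↑ˡ_; _↑ʳ_)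
import Data.Fin as F
import Data.Fin.Properties as Finₚ
open import Data.Fin.Subset using (Subset; _∈_; _∉_; ∣_∣; inside; ⊥)
open import Data.Fin.Subset.Properties using (_∈?_; ∣⊥∣≡0)
open import Data.List using (List; []; _∷_; length; map; filter; allFin; _++_)
import Data.List
open import Data.List.Membership.Propositional using () renaming (_∈_ to _∈ₗ_)
open import Data.List.Membership.Propositional.Properties using (∈-map⁺; ∈-++⁺ˡ; ∈-++⁺ʳ; ∈-allFin; ∈-filter⁺)
open import Data.List.Properties using (length-map; length-++; length-tabulate)
open import Data.List.Relation.Unary.All using ([]; _∷_)
open import Data.List.Relation.Unary.AllPairs using ([]; _∷_)
open import Data.List.Relation.Unary.Any using (here; there)
open import Data.List.Relation.Unary.Any.Properties using (lookup-index)
open import Data.Maybe using (Maybe; just; nothing; maybe)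
import Data.Maybe.Properties as Maybeₚ
open import Data.Nat using (zero; _*_; _∸_; _<_; z≤n; s≤s; _≟_; _<?_; _≤?_; ⌈_/2⌉; ⌊_/2⌋)
open import Data.Nat.DivMod using (_%_; m%n<n; %-distribˡ-+; [m+kn]%n≡m%n; [m+n]%n≡m%n; m<n⇒m%n≡m; m%n%n≡m%n)
open import Data.Nat.Divisibility using (divides; ∣m+n∣m⇒∣n; ∣1⇒≡1)
open import Data.Nat.Properties
open import Data.Nat.Solver using (module +-*-Solver)
open import Algebra.Properties.CommutativeSemigroup +-commutativeSemigroup using (interchange; x∙yz≈y∙xz)
open import Algebra.Properties.Semiring.Sum +-*-semiring
  using (sum; sum-syntax; sum-cong-≗; sum-replicate-zero; ∑-distrib-+; *-distribˡ-sum)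
open import Data.Product using (Σ; ∃; _,_; proj₁; proj₂)
import Data.Product as Product
open import Data.Sum using (_⊎_; inj₁; inj₂; [_,_])
import Data.Sum
open import Data.Vec using ([]; _∷_; lookup)
open import Data.Vec.Base using (_[_]=_; here; there)
import Data.Vec.Properties as Vecₚ
open import Function using (_∘_; _∘′_)
open import Function.Definitions using (Injective)
open import Relation.Binary.Definitions using (DecidableEquality; Tri; tri<; tri≈; tri>)
open import Relation.Binary.PropositionalEquality
  using (_≢_; refl; sym; trans; cong; cong₂; subst; subst₂; module ≡-Reasoning)
open import Relation.Nullary using (yes; no; does; Dec)
open import Relation.Nullary.Decidable using (dec-false)
open import Relation.Unary using (Decidable)

-- Finite sums and counting

indicator : Bool → ℕ
indicator true  = 1
indicator false = 0

indicator≤1 : ∀ b → indicator b ≤ 1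
indicator≤1 true  = ≤-refl
indicator≤1 false = z≤n

sum-mono-≤ : ∀ {k} {f g : Fin k → ℕ} → (∀ i → f i ≤ g i) → sum f ≤ sum g
sum-mono-≤ {zero}  f≤g = z≤n
sum-mono-≤ {suc k} {f} {g} f≤g =
  +-mono-≤ (f≤g zero) (sum-mono-≤ {f = λ i → f (suc i)} {g = λ i → g (suc i)} (λ i → f≤g (suc i)))

sum-↑ : ∀ n m (f : Fin (n + m) → ℕ) →
        sum f ≡ ∑[ i < n ] f (i ↑ˡ m) + ∑[ j < m ] f (n ↑ʳ j)
sum-↑ zero    m f = refl
sum-↑ (suc n) m f = trans (cong (f zero +_) (sum-↑ n m (λ i → f (suc i))))
                          (sym (+-assoc (f zero) _ _))

sum-indicator≤ : ∀ {k} (b : Fin k → Bool) → ∑[ i < k ] indicator (b i) ≤ k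
sum-indicator≤ {zero}  b = z≤n
sum-indicator≤ {suc k} b = +-mono-≤ (indicator≤1 (b zero)) (sum-indicator≤ (λ i → b (suc i)))

sum-indicator+sum-indicator-not : ∀ {k} (b : Fin k → Bool) →
  ∑[ i < k ] indicator (b i) + ∑[ i < k ] indicator (not (b i)) ≡ k
sum-indicator+sum-indicator-not {zero}  b = refl
sum-indicator+sum-indicator-not {suc k} b with b zero | sum-indicator+sum-indicator-not (λ i → b (suc i))
... | true  | ih = cong suc ih
... | false | ih = trans (+-suc _ _) (cong suc ih)

∣p∣≡sum-indicator : ∀ {N} (p : Subset N) → ∣ p ∣ ≡ ∑[ x < N ] indicator (lookup p x)
∣p∣≡sum-indicator []           = refl
∣p∣≡sum-indicator (true  ∷ p) = cong suc (∣p∣≡sum-indicator p)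
∣p∣≡sum-indicator (false ∷ p) = ∣p∣≡sum-indicator p

allFin⊆⇒≤length : ∀ {p} (xs : List (Fin p)) → (∀ i → i ∈ₗ xs) → p ≤ length xs
allFin⊆⇒≤length xs ∈xs = Finₚ.injective⇒≤ λ {i} {j} eq →
  trans (lookup-index (∈xs i)) (trans (cong (Data.List.lookup xs) eq) (sym (lookup-index (∈xs j))))

length-filter-∷ : ∀ {A : Set} {P : A → Set} (P? : Decidable P) x xs →
  length (filter P? (x ∷ xs)) ≡ indicator (does (P? x)) + length (filter P? xs)
length-filter-∷ P? x xs with does (P? x)
... | true  = refl
... | false = refl

⌈/2⌉≤ : ∀ {p c} → p ≤ 2 * c → ⌈ p /2⌉ ≤ c
⌈/2⌉≤ {p} {c} p≤2c = go p c (subst (p ≤_) (cong (c +_) (+-identityʳ c)) p≤2c)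
  where
  go : ∀ p c → p ≤ c + c → ⌈ p /2⌉ ≤ c
  go zero          c       _              = z≤n
  go (suc zero)    (suc c) _              = s≤s z≤n
  go (suc (suc p)) (suc c) (s≤s p+1≤c+c+1) =
    s≤s (go p c (≤-pred (subst (suc p ≤_) (+-suc c c) p+1≤c+c+1)))

endpoints : {A : Set} → List (A × A) → List A
endpoints []             = []
endpoints ((s , t) ∷ xs) = s ∷ t ∷ endpoints xs

length-endpoints : ∀ {A : Set} (xs : List (A × A)) → length (endpoints xs) ≡ 2 * length xs
length-endpoints []       = refl
length-endpoints (_ ∷ xs) = cong suc (trans (cong suc (length-endpoints xs)) (sym (+-suc _ _)))

∈-endpoints⁺ : ∀ {A : Set} {u s t : A} {xs} → (s , t) ∈ₗ xs → u ≡ s ⊎ u ≡ t → u ∈ₗ endpoints xs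
∈-endpoints⁺ (here refl) (inj₁ refl) = here refl
∈-endpoints⁺ (here refl) (inj₂ refl) = there (here refl)
∈-endpoints⁺ {xs = _ ∷ _} (there st∈) u∈ = there (there (∈-endpoints⁺ st∈ u∈))

increasingPairs : (p : ℕ) → List (Fin p × Fin p)
increasingPairs zero    = []
increasingPairs (suc p) = map (λ j → zero , suc j) (allFin p) ++ map (Product.map suc suc) (increasingPairs p)

∈-increasingPairs : ∀ {p} {i j : Fin p} → toℕ i < toℕ j → (i , j) ∈ₗ increasingPairs p
∈-increasingPairs {suc p} {zero}  {suc j} _         = ∈-++⁺ˡ (∈-map⁺ (λ j → zero , suc j) (∈-allFin j))
∈-increasingPairs {suc p} {suc i} {suc j} (s≤s i<j) =
  ∈-++⁺ʳ (map (λ j → zero , suc j) (allFin p)) (∈-map⁺ (Product.map suc suc) (∈-increasingPairs i<j))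

2*length-increasingPairs : ∀ p → 2 * length (increasingPairs p) ≡ p * (p ∸ 1)
2*length-increasingPairs zero    = refl
2*length-increasingPairs (suc p) = begin
  2 * length (increasingPairs (suc p))
    ≡⟨ cong (2 *_) (trans (length-++ (map (λ j → zero , suc j) (allFin p)))
                          (cong₂ _+_ (trans (length-map _ (allFin p)) (length-tabulate {n = p} (λ i → i)))
                                     (length-map _ (increasingPairs p)))) ⟩
  2 * (p + length (increasingPairs p))
    ≡⟨ *-distribˡ-+ 2 p _ ⟩
  2 * p + 2 * length (increasingPairs p)
    ≡⟨ cong (2 * p +_) (2*length-increasingPairs p) ⟩
  2 * p + p * (p ∸ 1)
    ≡⟨ 2p+p[p∸1]≡[1+p]p p ⟩
  suc p * p ∎
  where
  open ≡-Reasoning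
  2p+p[p∸1]≡[1+p]p : ∀ p → 2 * p + p * (p ∸ 1) ≡ suc p * p
  2p+p[p∸1]≡[1+p]p zero    = refl
  2p+p[p∸1]≡[1+p]p (suc p) = solve 1 (λ p → con 2 :* (con 1 :+ p) :+ (con 1 :+ p) :* p
                                            := (con 2 :+ p) :* (con 1 :+ p)) refl p
    where open +-*-Solver

module Fibres {A B : Set} (_≟_ : DecidableEquality B) (f : A → Maybe B) where

  _≟ₘ_ : DecidableEquality (Maybe B)
  _≟ₘ_ = Maybeₚ.≡-dec _≟_

  fibre : B → List A → List A
  fibre b = filter (λ a → f a ≟ₘ just b)

  sum-indicator-hits≤1 : ∀ {q} (g : Fin q → B) → Injective _≡_ _≡_ g → ∀ y →
    ∑[ j < q ] indicator (does (y ≟ₘ just (g j))) ≤ 1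
  sum-indicator-hits≤1 {zero}  g g-inj y = z≤n
  sum-indicator-hits≤1 {suc q} g g-inj y with y ≟ₘ just (g zero)
  ... | no _     = sum-indicator-hits≤1 (λ j → g (suc j)) (λ eq → Finₚ.suc-injective (g-inj eq)) y
  ... | yes refl = s≤s (≤-reflexive (trans (sum-cong-≗ misses) (sum-replicate-zero q)))
    where
    misses : ∀ j → indicator (does (just (g zero) ≟ₘ just (g (suc j)))) ≡ 0
    misses j = cong indicator (dec-false (just (g zero) ≟ₘ just (g (suc j)))
                                         (λ eq → Finₚ.0≢1+n (g-inj (Maybeₚ.just-injective eq))))

  sum-length-fibre≤length : ∀ {q} (g : Fin q → B) → Injective _≡_ _≡_ g → ∀ L →
    ∑[ j < q ] length (fibre (g j) L) ≤ length L
  sum-length-fibre≤length {q} g g-inj []      = ≤-reflexive (sum-replicate-zero q)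
  sum-length-fibre≤length g g-inj (a ∷ L) = begin
    ∑[ j < _ ] length (fibre (g j) (a ∷ L))
      ≡⟨ sum-cong-≗ (λ j → length-filter-∷ (λ a → f a ≟ₘ just (g j)) a L) ⟩
    ∑[ j < _ ] (indicator (does (f a ≟ₘ just (g j))) + length (fibre (g j) L))
      ≡⟨ ∑-distrib-+ (λ j → indicator (does (f a ≟ₘ just (g j)))) (λ j → length (fibre (g j) L)) ⟩
    ∑[ j < _ ] indicator (does (f a ≟ₘ just (g j))) + ∑[ j < _ ] length (fibre (g j) L)
      ≤⟨ +-mono-≤ (sum-indicator-hits≤1 g g-inj (f a)) (sum-length-fibre≤length g g-inj L) ⟩
    suc (length L) ∎
    where open ≤-Reasoning

module PairMidpoints {B : Set} (_≟_ : DecidableEquality B) {p : ℕ} (mid : Fin p × Fin p → Maybe B) where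
  open Fibres _≟_ mid

  MidpointOfAll : B → Set
  MidpointOfAll b = ∀ u → ∃ λ π → π ∈ₗ increasingPairs p × mid π ≡ just b × (u ≡ proj₁ π ⊎ u ≡ proj₂ π)

  ⌈/2⌉≤length-fibre : ∀ {b} → MidpointOfAll b → ⌈ p /2⌉ ≤ length (fibre b (increasingPairs p))
  ⌈/2⌉≤length-fibre {b} covers = ⌈/2⌉≤ (subst (p ≤_) (length-endpoints fib) (allFin⊆⇒≤length (endpoints fib) ∈fib))
    where
    fib = fibre b (increasingPairs p)
    ∈fib : ∀ u → u ∈ₗ endpoints fib
    ∈fib u with covers u
    ... | π , π∈ , midπ , u∈π = ∈-endpoints⁺ (∈-filter⁺ (λ a → mid a ≟ₘ just b) π∈ midπ) u∈π

  midpoint-count : ∀ {q} (g : Fin q → B) → Injective _≡_ _≡_ g → (missing : Fin q → Bool) →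
    (∀ j → missing j ≡ true → MidpointOfAll (g j)) →
    2 * (⌈ p /2⌉ * ∑[ j < q ] indicator (missing j)) ≤ p * (p ∸ 1)
  midpoint-count g g-inj missing covers = begin
    2 * (⌈ p /2⌉ * ∑[ j < _ ] indicator (missing j))
      ≡⟨ cong (2 *_) (*-distribˡ-sum ⌈ p /2⌉ (λ j → indicator (missing j))) ⟩
    2 * ∑[ j < _ ] (⌈ p /2⌉ * indicator (missing j))
      ≤⟨ *-monoʳ-≤ 2 (sum-mono-≤ term≤) ⟩
    2 * ∑[ j < _ ] length (fibre (g j) (increasingPairs p))
      ≤⟨ *-monoʳ-≤ 2 (sum-length-fibre≤length g g-inj (increasingPairs p)) ⟩
    2 * length (increasingPairs p)
      ≡⟨ 2*length-increasingPairs p ⟩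
    p * (p ∸ 1) ∎
    where
    open ≤-Reasoning
    term≤ : ∀ j → ⌈ p /2⌉ * indicator (missing j) ≤ length (fibre (g j) (increasingPairs p))
    term≤ j with missing j in eq
    ... | true  = subst (_≤ length (fibre (g j) (increasingPairs p))) (sym (*-identityʳ ⌈ p /2⌉))
                        (⌈/2⌉≤length-fibre (covers j eq))
    ... | false = subst (_≤ length (fibre (g j) (increasingPairs p))) (sym (*-zeroʳ ⌈ p /2⌉)) z≤n

initialSegment : ∀ N → ℕ → Subset N
initialSegment zero    _       = []
initialSegment (suc N) zero    = ⊥
initialSegment (suc N) (suc k) = inside ∷ initialSegment N k

∣initialSegment∣ : ∀ {N k} → k ≤ N → ∣ initialSegment N k ∣ ≡ k
∣initialSegment∣ {zero}  z≤n       = refl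
∣initialSegment∣ {suc N} {zero}  _ = ∣⊥∣≡0 (suc N)
∣initialSegment∣ {suc N} {suc k} (s≤s k≤N) = cong suc (∣initialSegment∣ k≤N)

∈initialSegment : ∀ {N k} {i : Fin N} → toℕ i < k → i ∈ initialSegment N k
∈initialSegment {suc N} {suc k} {zero}  _         = here
∈initialSegment {suc N} {suc k} {suc i} (s≤s i<k) = there (∈initialSegment i<k)

∈-irrelevant : ∀ {N} {x : Fin N} {X : Subset N} (p q : x ∈ X) → p ≡ q
∈-irrelevant = go
  where
  go : ∀ {N} {x : Fin N} {xs : Subset N} {b : Bool} (p q : xs [ x ]= b) → p ≡ q
  go here      here      = refl
  go (there p) (there q) = cong there (go p q)

missing⇒∉ : ∀ {N} {X : Subset N} {x} → not (lookup X x) ≡ true → x ∉ X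
missing⇒∉ {X = X} {x} missing x∈X with lookup X x | Vecₚ.[]=⇒lookup x∈X
missing⇒∉ () _ | true | refl

-- Edge colourings of complete graphs

-- Every colour class c < k is an edge cover of K_n: vertex i meets it in the edge {i, partner c i}.
-- Vertices and colours are naturals; values outside i < n and c < k are junk.
record EdgeCoverColouring (n k : ℕ) : Set where
  field
    colour         : ℕ → ℕ → ℕ
    partner        : ℕ → ℕ → ℕ
    colour-sym     : ∀ i j → colour i j ≡ colour j i
    partner<       : ∀ {c i} → c < k → i < n → partner c i < n
    partner≢       : ∀ {c i} → c < k → i < n → partner c i ≢ i
    colour-partner : ∀ {c i} → c < k → i < n → colour i (partner c i) ≡ c

restrictColours : ∀ {n k k′} → k′ ≤ k → EdgeCoverColouring n k → EdgeCoverColouring n k′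
restrictColours k′≤k D = record
  { colour         = colour
  ; partner        = partner
  ; colour-sym     = colour-sym
  ; partner<       = λ c<k′ → partner< (≤-trans c<k′ k′≤k)
  ; partner≢       = λ c<k′ → partner≢ (≤-trans c<k′ k′≤k)
  ; colour-partner = λ c<k′ → colour-partner (≤-trans c<k′ k′≤k)
  }
  where open EdgeCoverColouring D

-- The new vertex n is joined to i in colour i, so it meets colour c at vertex c; hence k ≤ n.
addVertex : ∀ {n k} → k ≤ n → EdgeCoverColouring n k → EdgeCoverColouring (suc n) k
addVertex {n} {k} k≤n D = record
  { colour         = colour′
  ; partner        = partner′
  ; colour-sym     = colour′-sym
  ; partner<       = partner′<
  ; partner≢       = partner′≢
  ; colour-partner = colour′-partner
  }
  where
  open EdgeCoverColouring D

  colour′ : ℕ → ℕ → ℕ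
  colour′ i j with i ≟ n | j ≟ n
  ... | yes _ | _     = j
  ... | no _  | yes _ = i
  ... | no _  | no _  = colour i j

  partner′ : ℕ → ℕ → ℕ
  partner′ c i with i ≟ n
  ... | yes _ = c
  ... | no _  = partner c i

  colour′-sym : ∀ i j → colour′ i j ≡ colour′ j i
  colour′-sym i j with i ≟ n | j ≟ n
  ... | yes refl | yes refl = refl
  ... | yes _    | no _     = refl
  ... | no _     | yes _    = refl
  ... | no _     | no _     = colour-sym i j

  colour′-new : ∀ j → colour′ n j ≡ j
  colour′-new j with n ≟ n
  ... | yes _   = refl
  ... | no n≢n = ⊥-elim (n≢n refl)

  colour′-old : ∀ i j → i ≢ n → j ≢ n → colour′ i j ≡ colour i j
  colour′-old i j i≢n j≢n with i ≟ n | j ≟ n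
  ... | yes i≡n | _       = ⊥-elim (i≢n i≡n)
  ... | no _    | yes j≡n = ⊥-elim (j≢n j≡n)
  ... | no _    | no _    = refl

  partner′-new : ∀ c → partner′ c n ≡ c
  partner′-new c with n ≟ n
  ... | yes _   = refl
  ... | no n≢n = ⊥-elim (n≢n refl)

  partner′-old : ∀ c i → i ≢ n → partner′ c i ≡ partner c i
  partner′-old c i i≢n with i ≟ n
  ... | yes i≡n = ⊥-elim (i≢n i≡n)
  ... | no _    = refl

  old : ∀ {i} → i < suc n → i ≢ n → i < n
  old i<1+n i≢n = ≤∧≢⇒< (≤-pred i<1+n) i≢n

  partner′< : ∀ {c i} → c < k → i < suc n → partner′ c i < suc n
  partner′< {c} {i} c<k i<1+n with i ≟ n
  ... | yes _   = m≤n⇒m≤1+n (<-≤-trans c<k k≤n)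
  ... | no i≢n = m≤n⇒m≤1+n (partner< c<k (old i<1+n i≢n))

  partner′≢ : ∀ {c i} → c < k → i < suc n → partner′ c i ≢ i
  partner′≢ {c} {i} c<k i<1+n with i ≟ n
  ... | yes refl = <⇒≢ (<-≤-trans c<k k≤n)
  ... | no i≢n  = partner≢ c<k (old i<1+n i≢n)

  colour′-partner : ∀ {c i} → c < k → i < suc n → colour′ i (partner′ c i) ≡ c
  colour′-partner {c} {i} c<k i<1+n = by-cases (i ≟ n)
    where
    open ≡-Reasoning
    by-cases : Dec (i ≡ n) → colour′ i (partner′ c i) ≡ c
    by-cases (yes refl) = trans (cong (colour′ n) (partner′-new c)) (colour′-new c)
    by-cases (no i≢n)   = begin
      colour′ i (partner′ c i) ≡⟨ cong (colour′ i) (partner′-old c i i≢n) ⟩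
      colour′ i (partner c i)  ≡⟨ colour′-old i _ i≢n (<⇒≢ (partner< c<k i<n)) ⟩
      colour i (partner c i)   ≡⟨ colour-partner c<k i<n ⟩
      c                        ∎
      where i<n = old i<1+n i≢n

-- The classical 1-factorisation of K_{q+1} for odd q = 2h + 1, with vertex q playing ∞:
-- {i, j} gets colour i + j and {i, ∞} colour 2i (mod q). Since 2(h + 1) ≡ 1 (mod q), the
-- partner of ∞ in colour c is c(h + 1).
module RoundRobin (h : ℕ) where

  q : ℕ
  q = suc (h + h)

  colour : ℕ → ℕ → ℕ
  colour i j with i ≟ q | j ≟ q
  ... | yes _ | _     = (j + j) % q
  ... | no _  | yes _ = (i + i) % q
  ... | no _  | no _  = (i + j) % q

  partner : ℕ → ℕ → ℕ
  partner c i with i ≟ q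
  ... | yes _ = (c * suc h) % q
  ... | no _ with (i + i) % q ≟ c
  ...   | yes _ = q
  ...   | no _  = (c + (q ∸ i)) % q

  colour-sym : ∀ i j → colour i j ≡ colour j i
  colour-sym i j with i ≟ q | j ≟ q
  ... | yes refl | yes refl = refl
  ... | yes _    | no _     = refl
  ... | no _     | yes _    = refl
  ... | no _     | no _     = cong (_% q) (+-comm i j)

  colour-∞ : ∀ j → colour q j ≡ (j + j) % q
  colour-∞ j with q ≟ q
  ... | yes _   = refl
  ... | no q≢q = ⊥-elim (q≢q refl)

  colour-finite : ∀ i j → i ≢ q → j ≢ q → colour i j ≡ (i + j) % q
  colour-finite i j i≢q j≢q with i ≟ q | j ≟ q
  ... | yes i≡q | _       = ⊥-elim (i≢q i≡q)
  ... | no _    | yes j≡q = ⊥-elim (j≢q j≡q)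
  ... | no _    | no _    = refl

  partner-∞ : ∀ c → partner c q ≡ (c * suc h) % q
  partner-∞ c with q ≟ q
  ... | yes _   = refl
  ... | no q≢q = ⊥-elim (q≢q refl)

  partner-to-∞ : ∀ c i → i ≢ q → (i + i) % q ≡ c → partner c i ≡ q
  partner-to-∞ c i i≢q 2i≡c with i ≟ q
  ... | yes i≡q = ⊥-elim (i≢q i≡q)
  ... | no _ with (i + i) % q ≟ c
  ...   | yes _    = refl
  ...   | no 2i≢c = ⊥-elim (2i≢c 2i≡c)

  partner-finite : ∀ c i → i ≢ q → (i + i) % q ≢ c → partner c i ≡ (c + (q ∸ i)) % q
  partner-finite c i i≢q 2i≢c with i ≟ q
  ... | yes i≡q = ⊥-elim (i≢q i≡q)
  ... | no _ with (i + i) % q ≟ c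
  ...   | yes 2i≡c = ⊥-elim (2i≢c 2i≡c)
  ...   | no _     = refl

  %q≢q : ∀ x → x % q ≢ q
  %q≢q x = <⇒≢ (m%n<n x q)

  halve-double : ∀ {c} → c < q → ((c * suc h) % q + (c * suc h) % q) % q ≡ c
  halve-double {c} c<q = begin
    ((c * suc h) % q + (c * suc h) % q) % q ≡⟨ %-distribˡ-+ (c * suc h) (c * suc h) q ⟨
    (c * suc h + c * suc h) % q             ≡⟨ cong (_% q) (*-distribˡ-+ c (suc h) (suc h)) ⟨
    (c * (suc h + suc h)) % q               ≡⟨ cong (λ x → (c * suc x) % q) (+-suc h h) ⟩
    (c * suc q) % q                         ≡⟨ cong (_% q) (*-suc c q) ⟩
    (c + c * q) % q                         ≡⟨ [m+kn]%n≡m%n c c q ⟩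
    c % q                                   ≡⟨ m<n⇒m%n≡m c<q ⟩
    c                                       ∎
    where open ≡-Reasoning

  add-shift : ∀ {c i} → c < q → i ≤ q → (i + (c + (q ∸ i)) % q) % q ≡ c
  add-shift {c} {i} c<q i≤q = begin
    (i + (c + (q ∸ i)) % q) % q             ≡⟨ %-distribˡ-+ i _ q ⟩
    (i % q + (c + (q ∸ i)) % q % q) % q     ≡⟨ cong (λ x → (i % q + x) % q) (m%n%n≡m%n (c + (q ∸ i)) q) ⟩
    (i % q + (c + (q ∸ i)) % q) % q         ≡⟨ %-distribˡ-+ i _ q ⟨
    (i + (c + (q ∸ i))) % q                 ≡⟨ cong (_% q) (x∙yz≈y∙xz i c (q ∸ i)) ⟩
    (c + (i + (q ∸ i))) % q                 ≡⟨ cong (λ x → (c + x) % q) (m+[n∸m]≡n i≤q) ⟩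
    (c + q) % q                             ≡⟨ [m+n]%n≡m%n c q ⟩
    c % q                                   ≡⟨ m<n⇒m%n≡m c<q ⟩
    c                                       ∎
    where open ≡-Reasoning

  colour-partner : ∀ {c i} → c < q → i < suc q → colour i (partner c i) ≡ c
  colour-partner {c} {i} c<q i<1+q = by-cases (i ≟ q) ((i + i) % q ≟ c)
    where
    by-cases : Dec (i ≡ q) → Dec ((i + i) % q ≡ c) → colour i (partner c i) ≡ c
    by-cases (yes refl) _ =
      trans (cong (colour q) (partner-∞ c)) (trans (colour-∞ _) (halve-double c<q))
    by-cases (no i≢q) (yes 2i≡c) =
      trans (cong (colour i) (partner-to-∞ c i i≢q 2i≡c))
            (trans (colour-sym i q) (trans (colour-∞ i) 2i≡c))
    by-cases (no i≢q) (no 2i≢c) =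
      trans (cong (colour i) (partner-finite c i i≢q 2i≢c))
            (trans (colour-finite i _ i≢q (%q≢q (c + (q ∸ i)))) (add-shift c<q (≤-pred i<1+q)))

  partner< : ∀ {c i} → c < q → i < suc q → partner c i < suc q
  partner< {c} {i} _ _ with i ≟ q
  ... | yes _ = m≤n⇒m≤1+n (m%n<n (c * suc h) q)
  ... | no _ with (i + i) % q ≟ c
  ...   | yes _ = ≤-refl
  ...   | no _  = m≤n⇒m≤1+n (m%n<n (c + (q ∸ i)) q)

  partner≢ : ∀ {c i} → c < q → i < suc q → partner c i ≢ i
  partner≢ {c} {i} c<q i<1+q = by-cases (i ≟ q) ((i + i) % q ≟ c)
    where
    by-cases : Dec (i ≡ q) → Dec ((i + i) % q ≡ c) → partner c i ≢ i
    by-cases (yes refl) _ eq = %q≢q (c * suc h) (trans (sym (partner-∞ c)) eq)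
    by-cases (no i≢q) (yes 2i≡c) eq = i≢q (trans (sym eq) (partner-to-∞ c i i≢q 2i≡c))
    by-cases (no i≢q) (no 2i≢c) eq = 2i≢c (begin
      (i + i) % q              ≡⟨ colour-finite i i i≢q i≢q ⟨
      colour i i               ≡⟨ cong (colour i) eq ⟨
      colour i (partner c i)   ≡⟨ colour-partner c<q i<1+q ⟩
      c                        ∎)
      where open ≡-Reasoning

  roundRobin : EdgeCoverColouring (suc q) q
  roundRobin = record
    { colour         = colour
    ; partner        = partner
    ; colour-sym     = colour-sym
    ; partner<       = partner<
    ; partner≢       = partner≢
    ; colour-partner = colour-partner
    }

-- Strong edge geodetic sets in graphs of diameter at most 2

module _ (G : Graph) where
  open Graph G renaming (sym to adj-sym)

  adj⇒≢ : ∀ {u v} → Adj u v → u ≢ v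
  adj⇒≢ {u} uv refl = irrefl uv

  edgePath : ∀ {u v} → Adj u v → ShortestPath G u v
  edgePath {u} {v} uv = mkShortest 1 (mkPath (uv ∷ []) ((adj⇒≢ uv ∷ []) ∷ [] ∷ [])) 1≤
    where
    1≤ : ∀ {k} → Path G u v k → 1 ≤ k
    1≤ (mkPath []      (_ ∷ _)) = ⊥-elim (adj⇒≢ uv refl)
    1≤ (mkPath (_ ∷ _) _)       = s≤s z≤n

  twoStepPath : ∀ {u w v} → Adj u w → Adj w v → u ≢ v → ¬ Adj u v → ShortestPath G u v
  twoStepPath {u} {w} {v} uw wv u≢v ¬uv =
    mkShortest 2 (mkPath (uw ∷ wv ∷ []) ((adj⇒≢ uw ∷ u≢v ∷ []) ∷ (adj⇒≢ wv ∷ []) ∷ [] ∷ [])) 2≤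
    where
    2≤ : ∀ {k} → Path G u v k → 2 ≤ k
    2≤ (mkPath []               _) = ⊥-elim (u≢v refl)
    2≤ (mkPath (uv ∷ [])        _) = ⊥-elim (¬uv uv)
    2≤ (mkPath (_ ∷ _ ∷ _)      _) = s≤s (s≤s z≤n)

  midpoint : ∀ {u v k} → Walk G u v k → Maybe (Fin N)
  midpoint (_∷_ {w = w} _ (_ ∷ [])) = just w
  midpoint _                        = nothing

  edgeOn-walk≤2 : ∀ {s t k x y} (p : Walk G s t k) → k ≤ 2 → EdgeOnWalk G x y p →
    x ≡ s ⊎ x ≡ t ⊎ (midpoint p ≡ just x × (y ≡ s ⊎ y ≡ t) × Adj x s × Adj x t)
  edgeOn-walk≤2 (_ ∷ [])             _ (here→ _)              = inj₁ refl
  edgeOn-walk≤2 (_ ∷ [])             _ (here← _ refl)         = inj₂ (inj₁ refl)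
  edgeOn-walk≤2 (_ ∷ _ ∷ [])         _ (here→ _)              = inj₁ refl
  edgeOn-walk≤2 (sx ∷ xt ∷ [])       _ (here← refl refl)      = inj₂ (inj₂ (refl , inj₁ refl , adj-sym sx , xt))
  edgeOn-walk≤2 (sx ∷ xt ∷ [])       _ (there (here→ refl))   = inj₂ (inj₂ (refl , inj₂ refl , adj-sym sx , xt))
  edgeOn-walk≤2 (_ ∷ _ ∷ [])         _ (there (here← _ refl)) = inj₂ (inj₁ refl)
  edgeOn-walk≤2 (_ ∷ _ ∷ _ ∷ _)      (s≤s (s≤s ())) _

Diameter≤2 : Graph → Set
Diameter≤2 G = ∀ s t → s ≢ t → ∃ λ k → k ≤ 2 × Path G s t k

module StrongEdgeGeodeticDiameter≤2
  (G : Graph) (diam≤2 : Diameter≤2 G) {X : Subset (Graph.N G)} (seg : IsStrongEdgeGeodetic G X) where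

  open Graph G using (N; Adj)
  open ShortestPath using (len; path)

  walkOf : ∀ {s t} (P : ShortestPath G s t) → Walk G s t (len P)
  walkOf P = Path.walk (path P)

  assignedMidpoint : Fin N → Fin N → Maybe (Fin N)
  assignedMidpoint s t with s ∈? X | t ∈? X | s F.<? t
  ... | yes s∈X | yes t∈X | yes s<t = maybe (λ P → midpoint G (walkOf P)) nothing
                                        (proj₁ seg s t s∈X t∈X s<t)
  ... | _       | _       | _       = nothing

  assignedMidpoint-just : ∀ {s t} s∈X t∈X s<t {P} → proj₁ seg s t s∈X t∈X s<t ≡ just P →
                          assignedMidpoint s t ≡ midpoint G (walkOf P)
  assignedMidpoint-just {s} {t} s∈X t∈X s<t assigned with s ∈? X | t ∈? X | s F.<? t
  ... | yes s∈X′ | yes t∈X′ | yes s<t′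
    rewrite ∈-irrelevant s∈X′ s∈X | ∈-irrelevant t∈X′ t∈X | ≤-irrelevant s<t′ s<t | assigned = refl
  ... | no s∉X | _       | _       = ⊥-elim (s∉X s∈X)
  ... | yes _  | no t∉X  | _       = ⊥-elim (t∉X t∈X)
  ... | yes _  | yes _   | no s≮t  = ⊥-elim (s≮t s<t)

  record ThroughMidpoint (x y : Fin N) : Set where
    field
      s t      : Fin N
      s∈X      : s ∈ X
      t∈X      : t ∈ X
      s<t      : s F.< t
      assigned : assignedMidpoint s t ≡ just x
      y∈st     : y ≡ s ⊎ y ≡ t
      x~s      : Adj x s
      x~t      : Adj x t

  geodesic≤2 : ∀ {s t} → s ≢ t → (P : ShortestPath G s t) → len P ≤ 2
  geodesic≤2 {s} {t} s≢t P with diam≤2 s t s≢t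
  ... | k , k≤2 , p = ≤-trans (ShortestPath.shortest P p) k≤2

  ∉⇒throughMidpoint : ∀ {x y} → Adj x y → x ∉ X → ThroughMidpoint x y
  ∉⇒throughMidpoint {x} {y} xy x∉X with proj₂ seg x y xy
  ... | s , t , s∈X , t∈X , s<t , P , assigned , xy∈P
    with edgeOn-walk≤2 G (walkOf P) (geodesic≤2 (Finₚ.<⇒≢ s<t) P) xy∈P
  ... | inj₁ refl        = ⊥-elim (x∉X s∈X)
  ... | inj₂ (inj₁ refl) = ⊥-elim (x∉X t∈X)
  ... | inj₂ (inj₂ (mid , y∈st , x~s , x~t)) = record
    { s = s ; t = t ; s∈X = s∈X ; t∈X = t∈X ; s<t = s<t
    ; assigned = trans (assignedMidpoint-just s∈X t∈X s<t assigned) mid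
    ; y∈st = y∈st ; x~s = x~s ; x~t = x~t }

  ∉⇒neighbour∈ : ∀ {x y} → Adj x y → x ∉ X → y ∈ X
  ∉⇒neighbour∈ xy x∉X with ∉⇒throughMidpoint xy x∉X
  ... | record { s∈X = s∈X ; y∈st = inj₁ refl } = s∈X
  ... | record { t∈X = t∈X ; y∈st = inj₂ refl } = t∈X

  -- A missing eQ j is the midpoint of assigned pairs covering all of eP, hence of at least
  -- ⌈p/2⌉ pairs, and distinct j use distinct pairs.
  missing-count : ∀ {p q} (eP : Fin p → Fin N) (eQ : Fin q → Fin N) →
    Injective _≡_ _≡_ eP → Injective _≡_ _≡_ eQ → (∀ {u u′} → eP u F.< eP u′ → u F.< u′) →
    (∀ j u → Adj (eQ j) (eP u)) → (∀ {j v} → Adj (eQ j) v → ∃ λ u → eP u ≡ v) →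
    2 * (⌈ p /2⌉ * ∑[ j < q ] indicator (not (lookup X (eQ j)))) ≤ p * (p ∸ 1)
  missing-count {p} eP eQ eP-inj eQ-inj reflect adj neighbours =
    midpoint-count eQ eQ-inj (λ j → not (lookup X (eQ j))) covers
    where
    open PairMidpoints Finₚ._≟_ (λ (u , u′) → assignedMidpoint (eP u) (eP u′))
    covers : ∀ j → not (lookup X (eQ j)) ≡ true → MidpointOfAll (eQ j)
    covers j missing u with ∉⇒throughMidpoint (adj j u) (missing⇒∉ missing)
    ... | r with neighbours (ThroughMidpoint.x~s r) | neighbours (ThroughMidpoint.x~t r)
    ...   | s′ , refl | t′ , refl =
      (s′ , t′) , ∈-increasingPairs (reflect s<t) , assigned , Data.Sum.map eP-inj eP-inj y∈st
      where open ThroughMidpoint r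

-- The complete bipartite graph

-- μ vertices of a part of size q may be missing from a strong edge geodetic set containing the
-- whole other part, of size p.
Feasible : ℕ → ℕ → ℕ → Set
Feasible p q μ = μ ≤ q × 2 * (⌈ p /2⌉ * μ) ≤ p * (p ∸ 1)

module CompleteBipartite (n m : ℕ) where

  V : Set
  V = Fin (n + m)

  left : Fin n → V
  left i = i ↑ˡ m

  right : Fin m → V
  right j = n ↑ʳ j

  toℕ-left : ∀ i → toℕ (left i) ≡ toℕ i
  toℕ-left i = Finₚ.toℕ-↑ˡ i m

  toℕ-right : ∀ j → toℕ (right j) ≡ n + toℕ j
  toℕ-right = Finₚ.toℕ-↑ʳ n

  left<n : ∀ i → toℕ (left i) < n
  left<n i = subst (_< n) (sym (toℕ-left i)) (Finₚ.toℕ<n i)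

  n≤right : ∀ j → n ≤ toℕ (right j)
  n≤right j = subst (n ≤_) (sym (toℕ-right j)) (m≤m+n n (toℕ j))

  ¬adj-left : ∀ {u v : V} → toℕ u < n → toℕ v < n → ¬ KAdj n m u v
  ¬adj-left u<n v<n (inj₁ (_ , n≤v)) = <⇒≱ v<n n≤v
  ¬adj-left u<n v<n (inj₂ (n≤u , _)) = <⇒≱ u<n n≤u

  ¬adj-right : ∀ {u v : V} → n ≤ toℕ u → n ≤ toℕ v → ¬ KAdj n m u v
  ¬adj-right n≤u n≤v (inj₁ (u<n , _)) = <⇒≱ u<n n≤u
  ¬adj-right n≤u n≤v (inj₂ (_ , v<n)) = <⇒≱ v<n n≤v

  diameter≤2 : 1 ≤ n → 1 ≤ m → Diameter≤2 (K n m)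
  diameter≤2 1≤n 1≤m s t s≢t with toℕ s <? n | toℕ t <? n
  ... | yes s<n | no t≮n = 1 , s≤s z≤n , ShortestPath.path (edgePath (K n m) (inj₁ (s<n , ≮⇒≥ t≮n)))
  ... | no s≮n | yes t<n = 1 , s≤s z≤n , ShortestPath.path (edgePath (K n m) (inj₂ (≮⇒≥ s≮n , t<n)))
  ... | yes s<n | yes t<n =
    2 , ≤-refl , ShortestPath.path (twoStepPath (K n m) (inj₁ (s<n , n≤w)) (inj₂ (n≤w , t<n)) s≢t (¬adj-left s<n t<n))
    where
    w = right (fromℕ< 1≤m)
    n≤w = n≤right (fromℕ< 1≤m)
  ... | no s≮n | no t≮n =
    2 , ≤-refl , ShortestPath.path (twoStepPath (K n m) (inj₂ (≮⇒≥ s≮n , w<n)) (inj₁ (w<n , ≮⇒≥ t≮n)) s≢t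
                                                 (¬adj-right (≮⇒≥ s≮n) (≮⇒≥ t≮n)))
    where
    w = left (fromℕ< 1≤n)
    w<n = left<n (fromℕ< 1≤n)

  left-reflects-< : ∀ {i i′} → left i F.< left i′ → i F.< i′
  left-reflects-< {i} {i′} = subst₂ _<_ (toℕ-left i) (toℕ-left i′)

  right-reflects-< : ∀ {j j′} → right j F.< right j′ → j F.< j′
  right-reflects-< {j} {j′} lt = +-cancelˡ-< n _ _ (subst₂ _<_ (toℕ-right j) (toℕ-right j′) lt)

  neighbour-of-right : ∀ {j v} → KAdj n m (right j) v → ∃ λ i → left i ≡ v
  neighbour-of-right {j} (inj₁ (j<n , _)) = ⊥-elim (<⇒≱ j<n (n≤right j))
  neighbour-of-right     (inj₂ (_ , v<n)) =
    fromℕ< v<n , Finₚ.toℕ-injective (trans (toℕ-left _) (Finₚ.toℕ-fromℕ< v<n))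

  neighbour-of-left : ∀ {i v} → KAdj n m (left i) v → ∃ λ j → right j ≡ v
  neighbour-of-left {i} {v} (inj₁ (_ , n≤v)) =
    fromℕ< v∸n<m , Finₚ.toℕ-injective (trans (toℕ-right _) (trans (cong (n +_) (Finₚ.toℕ-fromℕ< v∸n<m)) (m+[n∸m]≡n n≤v)))
    where
    v∸n<m : toℕ v ∸ n < m
    v∸n<m = +-cancelˡ-< n _ _ (subst (_< n + m) (sym (m+[n∸m]≡n n≤v)) (Finₚ.toℕ<n v))
  neighbour-of-left {i} (inj₂ (n≤i , _)) = ⊥-elim (<⇒≱ (left<n i) n≤i)

  missingˡ missingʳ : Subset (n + m) → ℕ
  missingˡ X = ∑[ i < n ] indicator (not (lookup X (left i)))
  missingʳ X = ∑[ j < m ] indicator (not (lookup X (right j)))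

  ∣X∣+missing : ∀ X → ∣ X ∣ + (missingˡ X + missingʳ X) ≡ n + m
  ∣X∣+missing X = begin
    ∣ X ∣ + (missingˡ X + missingʳ X)
      ≡⟨ cong (_+ (missingˡ X + missingʳ X)) (trans (∣p∣≡sum-indicator X) (sum-↑ n m (λ x → indicator (lookup X x)))) ⟩
    (insideˡ + insideʳ) + (missingˡ X + missingʳ X)
      ≡⟨ interchange insideˡ insideʳ (missingˡ X) (missingʳ X) ⟩
    (insideˡ + missingˡ X) + (insideʳ + missingʳ X)
      ≡⟨ cong₂ _+_ (sum-indicator+sum-indicator-not (λ i → lookup X (left i)))
                   (sum-indicator+sum-indicator-not (λ j → lookup X (right j))) ⟩
    n + m ∎
    where
    open ≡-Reasoning
    insideˡ = ∑[ i < n ] indicator (lookup X (left i))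
    insideʳ = ∑[ j < m ] indicator (lookup X (right j))

  module _ (1≤n : 1 ≤ n) (1≤m : 1 ≤ m) {X : Subset (n + m)} (seg : IsStrongEdgeGeodetic (K n m) X) where
    open StrongEdgeGeodeticDiameter≤2 (K n m) (diameter≤2 1≤n 1≤m) seg

    left⊆⊎right⊆ : (∀ i → left i ∈ X) ⊎ (∀ j → right j ∈ X)
    left⊆⊎right⊆ with Finₚ.all? (λ i → left i ∈? X)
    ... | yes allLeft = inj₁ allLeft
    ... | no ¬allLeft with Finₚ.¬∀⟶∃¬ n (λ i → left i ∈ X) (λ i → left i ∈? X) ¬allLeft
    ...   | i , i∉X = inj₂ λ j → ∉⇒neighbour∈ (inj₁ (left<n i , n≤right j)) i∉X

    allIn⇒missing≡0 : ∀ {k} (e : Fin k → V) → (∀ i → e i ∈ X) → ∑[ i < k ] indicator (not (lookup X (e i))) ≡ 0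
    allIn⇒missing≡0 {k} e allIn = trans (sum-cong-≗ λ i → cong (indicator ∘ not) (Vecₚ.[]=⇒lookup (allIn i)))
                                     (sum-replicate-zero k)

    lowerBound : ∃ λ μ → (Feasible n m μ ⊎ Feasible m n μ) × ∣ X ∣ + μ ≡ n + m
    lowerBound with left⊆⊎right⊆
    ... | inj₁ allLeft = missingʳ X , inj₁ (sum-indicator≤ _ ,
            missing-count left right (Finₚ.↑ˡ-injective m _ _) (Finₚ.↑ʳ-injective n _ _) left-reflects-<
                         (λ j i → inj₂ (n≤right j , left<n i)) neighbour-of-right) ,
          trans (cong (λ z → ∣ X ∣ + (z + missingʳ X)) (sym (allIn⇒missing≡0 left allLeft))) (∣X∣+missing X)
    ... | inj₂ allRight = missingˡ X , inj₂ (sum-indicator≤ _ ,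
            missing-count right left (Finₚ.↑ʳ-injective n _ _) (Finₚ.↑ˡ-injective m _ _) right-reflects-<
                         (λ i j → inj₁ (left<n i , n≤right j)) neighbour-of-left) ,
          trans (cong (∣ X ∣ +_) (trans (sym (+-identityʳ _)) (cong (missingˡ X +_) (sym (allIn⇒missing≡0 right allRight)))))
                (∣X∣+missing X)

  -- X is the left part together with t right vertices; the right vertex n + t + c, outside X,
  -- is the common midpoint of the assigned paths between the pairs of colour c.
  module Construction (t : ℕ) (t≤m : t ≤ m) (D : EdgeCoverColouring n (m ∸ t)) where
    open EdgeCoverColouring D

    X : Subset (n + m)
    X = initialSegment (n + m) (n + t)

    left∈X : ∀ {v : V} → toℕ v < n → v ∈ X
    left∈X v<n = ∈initialSegment (≤-trans v<n (m≤m+n n t))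

    t+c<m : ∀ {c} → c < m ∸ t → t + c < m
    t+c<m c<k = subst (_ <_) (m+[n∸m]≡n t≤m) (+-monoʳ-< _ c<k)

    hub : ∀ {c} → c < m ∸ t → V
    hub c<k = right (fromℕ< (t+c<m c<k))

    toℕ-hub : ∀ {c} (c<k : c < m ∸ t) → toℕ (hub c<k) ≡ n + (t + c)
    toℕ-hub c<k = trans (toℕ-right _) (cong (n +_) (Finₚ.toℕ-fromℕ< (t+c<m c<k)))

    n≤hub : ∀ {c} (c<k : c < m ∸ t) → n ≤ toℕ (hub c<k)
    n≤hub c<k = n≤right (fromℕ< (t+c<m c<k))

    assign : Assignment (K n m) X
    assign u v _ _ u<v with toℕ u <? n | toℕ v <? n
    ... | yes u<n | yes v<n with colour (toℕ u) (toℕ v) <? m ∸ t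
    ...   | yes c<k = just (twoStepPath (K n m) (inj₁ (u<n , n≤hub c<k)) (inj₂ (n≤hub c<k , v<n))
                                        (Finₚ.<⇒≢ u<v) (¬adj-left u<n v<n))
    ...   | no _    = nothing
    assign u v _ _ u<v | yes u<n | no v≮n = just (edgePath (K n m) (inj₁ (u<n , ≮⇒≥ v≮n)))
    assign u v _ _ u<v | no _    | _      = nothing

    assignedEdge : ∀ {u v} (u∈X : u ∈ X) (v∈X : v ∈ X) (u<v : u F.< v) → toℕ u < n → n ≤ toℕ v →
      Σ (ShortestPath (K n m) u v) λ P → (assign u v u∈X v∈X u<v ≡ just P) ×
        EdgeOn (K n m) u v P × EdgeOn (K n m) v u P
    assignedEdge {u} {v} _ _ _ u<n n≤v with toℕ u <? n | toℕ v <? n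
    ... | yes _  | no _    = _ , refl , here→ refl , here← refl refl
    ... | yes _  | yes v<n = ⊥-elim (<⇒≱ v<n n≤v)
    ... | no u≮n | _       = ⊥-elim (u≮n u<n)

    assignedViaHub : ∀ {u v w} (u∈X : u ∈ X) (v∈X : v ∈ X) (u<v : u F.< v) → toℕ u < n → toℕ v < n →
      colour (toℕ u) (toℕ v) < m ∸ t → toℕ w ≡ n + (t + colour (toℕ u) (toℕ v)) →
      Σ (ShortestPath (K n m) u v) λ P → (assign u v u∈X v∈X u<v ≡ just P) ×
        (EdgeOn (K n m) u w P × EdgeOn (K n m) w u P) × (EdgeOn (K n m) v w P × EdgeOn (K n m) w v P)
    assignedViaHub {u} {v} {w} _ _ _ u<n v<n c<k toℕw with toℕ u <? n | toℕ v <? n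
    ... | no u≮n | _       = ⊥-elim (u≮n u<n)
    ... | yes _  | no v≮n  = ⊥-elim (v≮n v<n)
    ... | yes _  | yes _ with colour (toℕ u) (toℕ v) <? m ∸ t
    ...   | no c≮k  = ⊥-elim (c≮k c<k)
    ...   | yes c<k′ with Finₚ.toℕ-injective (trans (toℕ-hub c<k′) (sym toℕw))
    ...     | refl = _ , refl , (here→ refl , here← refl refl) , (there (here← refl refl) , there (here→ refl))

    Covered : V → V → Set
    Covered x y = Σ V λ u → Σ V λ v → Σ (u ∈ X) λ u∈X → Σ (v ∈ X) λ v∈X → Σ (u F.< v) λ u<v →
      Σ (ShortestPath (K n m) u v) λ P → (assign u v u∈X v∈X u<v ≡ just P) × EdgeOn (K n m) x y P

    coverLeftRight : ∀ {x y} → toℕ x < n → n ≤ toℕ y → Covered x y × Covered y x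
    coverLeftRight {x} {y} x<n n≤y = by-cases (toℕ y <? n + t)
      where
      x∈X = left∈X x<n

      direct : toℕ y < n + t → Covered x y × Covered y x
      direct y<n+t with assignedEdge x∈X (∈initialSegment y<n+t) (<-≤-trans x<n n≤y) x<n n≤y
      ... | P , assigned , xy , yx =
        (_ , _ , x∈X , ∈initialSegment y<n+t , _ , P , assigned , xy) ,
        (_ , _ , x∈X , ∈initialSegment y<n+t , _ , P , assigned , yx)

      viaHub : n + t ≤ toℕ y → Covered x y × Covered y x
      viaHub n+t≤y = viaPartner (Finₚ.<-cmp x x′)
        where
        c = toℕ y ∸ (n + t)
        c<k : c < m ∸ t
        c<k = subst (c <_) ([m+n]∸[m+o]≡n∸o n m t) (∸-monoˡ-< (Finₚ.toℕ<n y) n+t≤y)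
        toℕy : toℕ y ≡ n + (t + c)
        toℕy = sym (trans (sym (+-assoc n t c)) (m+[n∸m]≡n n+t≤y))
        x′<n : partner c (toℕ x) < n
        x′<n = partner< c<k x<n
        x′ : V
        x′ = fromℕ< (≤-trans x′<n (m≤m+n n m))
        toℕx′ : toℕ x′ ≡ partner c (toℕ x)
        toℕx′ = Finₚ.toℕ-fromℕ< (≤-trans x′<n (m≤m+n n m))
        toℕx′<n : toℕ x′ < n
        toℕx′<n = subst (_< n) (sym toℕx′) x′<n
        x′∈X = left∈X toℕx′<n
        colour-xx′ : colour (toℕ x) (toℕ x′) ≡ c
        colour-xx′ = trans (cong (colour (toℕ x)) toℕx′) (colour-partner c<k x<n)
        colour-x′x : colour (toℕ x′) (toℕ x) ≡ c
        colour-x′x = trans (colour-sym _ _) colour-xx′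
        hubOf : ∀ {i j} → colour i j ≡ c → colour i j < m ∸ t × toℕ y ≡ n + (t + colour i j)
        hubOf eq = subst (_< m ∸ t) (sym eq) c<k , trans toℕy (cong (λ z → n + (t + z)) (sym eq))
        viaPartner : Tri (x F.< x′) (x ≡ x′) (x′ F.< x) → Covered x y × Covered y x
        viaPartner (tri< x<x′ _ _)
          with assignedViaHub x∈X x′∈X x<x′ x<n toℕx′<n (proj₁ (hubOf colour-xx′)) (proj₂ (hubOf colour-xx′))
        ... | P , assigned , (xy , yx) , _ =
          (_ , _ , x∈X , x′∈X , _ , P , assigned , xy) , (_ , _ , x∈X , x′∈X , _ , P , assigned , yx)
        viaPartner (tri> _ _ x′<x)
          with assignedViaHub x′∈X x∈X x′<x toℕx′<n x<n (proj₁ (hubOf colour-x′x)) (proj₂ (hubOf colour-x′x))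
        ... | P , assigned , _ , (xy , yx) =
          (_ , _ , x′∈X , x∈X , _ , P , assigned , xy) , (_ , _ , x′∈X , x∈X , _ , P , assigned , yx)
        viaPartner (tri≈ _ x≡x′ _) = ⊥-elim (partner≢ c<k x<n (sym (trans (cong toℕ x≡x′) toℕx′)))

      by-cases : Dec (toℕ y < n + t) → Covered x y × Covered y x
      by-cases (yes y<n+t) = direct y<n+t
      by-cases (no y≮n+t)  = viaHub (≮⇒≥ y≮n+t)

    isStrongEdgeGeodetic : IsStrongEdgeGeodetic (K n m) X
    isStrongEdgeGeodetic = assign , λ where
      x y (inj₁ (x<n , n≤y)) → proj₁ (coverLeftRight x<n n≤y)
      x y (inj₂ (n≤x , y<n)) → proj₂ (coverLeftRight y<n n≤x)

  upperBound : ∀ t → t ≤ m → EdgeCoverColouring n (m ∸ t) →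
    Σ (Subset (n + m)) λ X → IsStrongEdgeGeodetic (K n m) X × ∣ X ∣ ≡ n + t
  upperBound t t≤m D = X , isStrongEdgeGeodetic , ∣initialSegment∣ (+-monoʳ-≤ n t≤m)
    where open Construction t t≤m D

-- Parity and the five cases

parity : ∀ n → (∃ λ h → n ≡ h + h) ⊎ (∃ λ h → n ≡ suc (h + h))
parity zero    = inj₁ (0 , refl)
parity (suc n) with parity n
... | inj₁ (h , refl) = inj₂ (h , refl)
... | inj₂ (h , refl) = inj₁ (suc h , cong suc (sym (+-suc h h)))

2∣h+h : ∀ h → 2 ∣ h + h
2∣h+h h = divides h (trans (cong (h +_) (sym (+-identityʳ h))) (*-comm 2 h))

¬2∣1+h+h : ∀ h → ¬ 2 ∣ suc (h + h)
¬2∣1+h+h h 2∣1+h+h with ∣1⇒≡1 (∣m+n∣m⇒∣n (subst (2 ∣_) (+-comm 1 (h + h)) 2∣1+h+h) (2∣h+h h))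
... | ()

even⇒shape : ∀ {n} → 2 ∣ n → 2 ≤ n → ∃ λ h → n ≡ suc (suc (h + h))
even⇒shape {n} 2∣n 2≤n with parity n
... | inj₁ (zero  , refl) = ⊥-elim (<⇒≱ 2≤n z≤n)
... | inj₁ (suc h , refl) = h , cong suc (+-suc h h)
... | inj₂ (h , refl)     = ⊥-elim (¬2∣1+h+h h 2∣n)

odd⇒shape : ∀ {n} → ¬ 2 ∣ n → 2 ≤ n → ∃ λ h → n ≡ suc (suc (suc (h + h)))
odd⇒shape {n} ¬2∣n 2≤n with parity n
... | inj₁ (h , refl)     = ⊥-elim (¬2∣n (2∣h+h h))
... | inj₂ (zero  , refl) = ⊥-elim (<⇒≱ 2≤n (s≤s z≤n))
... | inj₂ (suc h , refl) = h , cong (suc ∘′ suc) (+-suc h h)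
  where open import Function using (_∘′_)

evenColouring : ∀ {n} → 2 ∣ n → 2 ≤ n → EdgeCoverColouring n (n ∸ 1)
evenColouring 2∣n 2≤n with even⇒shape 2∣n 2≤n
... | h , refl = RoundRobin.roundRobin h

oddColouring : ∀ {n} → ¬ 2 ∣ n → 2 ≤ n → EdgeCoverColouring n (n ∸ 2)
oddColouring ¬2∣n 2≤n with odd⇒shape ¬2∣n 2≤n
... | h , refl = addVertex (n≤1+n _) (RoundRobin.roundRobin h)

p≤2*⌈p/2⌉ : ∀ p → p ≤ 2 * ⌈ p /2⌉
p≤2*⌈p/2⌉ p = begin
  p                        ≡⟨ ⌊n/2⌋+⌈n/2⌉≡n p ⟨
  ⌊ p /2⌋ + ⌈ p /2⌉        ≤⟨ +-monoˡ-≤ ⌈ p /2⌉ (⌊n/2⌋≤⌈n/2⌉ p) ⟩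
  ⌈ p /2⌉ + ⌈ p /2⌉        ≡⟨ cong (⌈ p /2⌉ +_) (+-identityʳ ⌈ p /2⌉) ⟨
  2 * ⌈ p /2⌉              ∎
  where open ≤-Reasoning

2*⌈p/2⌉-odd : ∀ {p} → ¬ 2 ∣ p → 2 * ⌈ p /2⌉ ≡ suc p
2*⌈p/2⌉-odd {p} ¬2∣p with parity p
... | inj₁ (h , refl) = ⊥-elim (¬2∣p (2∣h+h h))
... | inj₂ (h , refl) = begin
  2 * suc ⌊ h + h /2⌋ ≡⟨ cong (λ x → 2 * suc x) (n≡⌊n+n/2⌋ h) ⟨
  2 * suc h           ≡⟨ cong suc (trans (cong (h +_) (+-identityʳ (suc h))) (+-suc h h)) ⟩
  suc (suc (h + h))   ∎
  where open ≡-Reasoning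

feasible⇒≤pred : ∀ {p q μ} → 1 ≤ p → Feasible p q μ → μ ≤ p ∸ 1
feasible⇒≤pred {suc r} {q} {μ} _ (_ , counted) = *-cancelˡ-≤ (suc r) (begin
  suc r * μ                 ≤⟨ *-monoˡ-≤ μ (p≤2*⌈p/2⌉ (suc r)) ⟩
  2 * ⌈ suc r /2⌉ * μ       ≡⟨ *-assoc 2 ⌈ suc r /2⌉ μ ⟩
  2 * (⌈ suc r /2⌉ * μ)     ≤⟨ counted ⟩
  suc r * r                 ∎)
  where open ≤-Reasoning

feasible-odd⇒≤ : ∀ {p q μ} → ¬ 2 ∣ p → 2 ≤ p → Feasible p q μ → μ ≤ p ∸ 2
feasible-odd⇒≤ {suc zero}    _    (s≤s ())
feasible-odd⇒≤ {suc (suc r)} {q} {μ} ¬2∣p _ (_ , counted) with μ ≤? r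
... | yes μ≤r = μ≤r
... | no μ≰r = ⊥-elim (<-irrefl refl (*-cancelˡ-≤ (suc r) (begin
  suc r * (3 + r)   ≡⟨ *-comm (suc r) (3 + r) ⟩
  (3 + r) * suc r   ≤⟨ *-monoʳ-≤ (3 + r) (≰⇒> μ≰r) ⟩
  (3 + r) * μ       ≡⟨ cong (_* μ) (2*⌈p/2⌉-odd ¬2∣p) ⟨
  2 * ⌈ 2 + r /2⌉ * μ ≡⟨ *-assoc 2 ⌈ 2 + r /2⌉ μ ⟩
  2 * (⌈ 2 + r /2⌉ * μ) ≤⟨ counted ⟩
  (2 + r) * suc r   ≡⟨ *-comm (2 + r) (suc r) ⟩
  suc r * (2 + r)   ∎)))
  where open ≤-Reasoning

sgₑ≡n+t : ∀ {n m} t → 1 ≤ n → 1 ≤ m → t ≤ m → EdgeCoverColouring n (m ∸ t) →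
  (∀ {μ} → Feasible n m μ → μ ≤ m ∸ t) → (∀ {μ} → Feasible m n μ → μ ≤ m ∸ t) →
  sgₑ≡ (K n m) (n + t)
sgₑ≡n+t {n} {m} t 1≤n 1≤m t≤m D boundˡ boundʳ = CompleteBipartite.upperBound n m t t≤m D , atLeast
  where
  atLeast : ∀ X → IsStrongEdgeGeodetic (K n m) X → n + t ≤ ∣ X ∣
  atLeast X seg with CompleteBipartite.lowerBound n m 1≤n 1≤m seg
  ... | μ , feasible , ∣X∣+μ≡n+m = +-cancelʳ-≤ μ (n + t) ∣ X ∣ (begin
    n + t + μ        ≤⟨ +-monoʳ-≤ (n + t) ([ boundˡ , boundʳ ] feasible) ⟩
    n + t + (m ∸ t)  ≡⟨ +-assoc n t (m ∸ t) ⟩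
    n + (t + (m ∸ t)) ≡⟨ cong (n +_) (m+[n∸m]≡n t≤m) ⟩
    n + m            ≡⟨ ∣X∣+μ≡n+m ⟨
    ∣ X ∣ + μ        ∎)
    where open ≤-Reasoning

sgₑ-even-balanced : ∀ {n} → 2 ≤ n → 2 ∣ n → sgₑ≡ (K n n) (n + 1)
sgₑ-even-balanced 2≤n 2∣n =
  sgₑ≡n+t 1 1≤n 1≤n 1≤n (evenColouring 2∣n 2≤n) (feasible⇒≤pred 1≤n) (feasible⇒≤pred 1≤n)
  where 1≤n = ≤-trans (s≤s z≤n) 2≤n

sgₑ-odd-balanced : ∀ {n} → 2 ≤ n → ¬ 2 ∣ n → sgₑ≡ (K n n) (n + 2)
sgₑ-odd-balanced 2≤n ¬2∣n =
  sgₑ≡n+t 2 1≤n 1≤n 2≤n (oddColouring ¬2∣n 2≤n) (feasible-odd⇒≤ ¬2∣n 2≤n) (feasible-odd⇒≤ ¬2∣n 2≤n)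
  where 1≤n = ≤-trans (s≤s z≤n) 2≤n

sgₑ-odd-nearlyBalanced : ∀ {n m} → 2 ≤ m → n ≡ m + 1 → ¬ 2 ∣ n → sgₑ≡ (K n m) (n + 1)
sgₑ-odd-nearlyBalanced {n} {m} 2≤m refl ¬2∣n =
  sgₑ≡n+t 1 (≤-trans 1≤m (m≤m+n m 1)) 1≤m 1≤m
    (subst (EdgeCoverColouring n) n∸2≡m∸1 (oddColouring ¬2∣n 2≤n))
    (λ {μ} f → subst (μ ≤_) n∸2≡m∸1 (feasible-odd⇒≤ ¬2∣n 2≤n f)) (feasible⇒≤pred 1≤m)
  where
  1≤m = ≤-trans (s≤s z≤n) 2≤m
  2≤n = ≤-trans 2≤m (m≤m+n m 1)
  n∸2≡m∸1 : (m + 1) ∸ 2 ≡ m ∸ 1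
  n∸2≡m∸1 = cong (_∸ 2) (+-comm m 1)

sgₑ-unbalanced : ∀ {n m} → 1 ≤ m → m ≤ n → EdgeCoverColouring n m → sgₑ≡ (K n m) n
sgₑ-unbalanced {n} {m} 1≤m m≤n D = subst (sgₑ≡ (K n m)) (+-identityʳ n)
  (sgₑ≡n+t 0 (≤-trans 1≤m m≤n) 1≤m z≤n D proj₁ (λ f → ≤-trans (feasible⇒≤pred 1≤m f) (m∸n≤m m 1)))

theorem2p1 : (n m : ℕ) → 2 ≤ m → m ≤ n →
    (2 ∣ n → (n ≡ m → sgₑ≡ (K n m) (n + 1))
            × (m + 1 ≤ n → sgₑ≡ (K n m) n))
    × (¬ (2 ∣ n) → (n ≡ m → sgₑ≡ (K n m) (n + 2))
             × (n ≡ m + 1 → sgₑ≡ (K n m) (n + 1))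
             × (m + 2 ≤ n → sgₑ≡ (K n m) n))
theorem2p1 n m 2≤m m≤n =
  (λ 2∣n → (λ n≡m → subst (λ k → sgₑ≡ (K n k) (n + 1)) n≡m (sgₑ-even-balanced 2≤n 2∣n))
         , (λ m+1≤n → sgₑ-unbalanced 1≤m m≤n
                        (restrictColours (m+n≤o⇒m≤o∸n m m+1≤n) (evenColouring 2∣n 2≤n)))) ,
  (λ ¬2∣n → (λ n≡m → subst (λ k → sgₑ≡ (K n k) (n + 2)) n≡m (sgₑ-odd-balanced 2≤n ¬2∣n))
          , (λ n≡m+1 → sgₑ-odd-nearlyBalanced 2≤m n≡m+1 ¬2∣n)
          , (λ m+2≤n → sgₑ-unbalanced 1≤m m≤n
                         (restrictColours (m+n≤o⇒m≤o∸n m m+2≤n) (oddColouring ¬2∣n 2≤n))))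
  where
  1≤m = ≤-trans (s≤s z≤n) 2≤m
  2≤n = ≤-trans 2≤m m≤n
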